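{- Let $G$ be a finite simple graph and let $A$ be a set of vertices of $G$. Suppose that $G$ has no matching which covers $A$ (i.e., no set of pairwise disjoint edges whose union contains $A$). Then there exists a set $S \subseteq A$ such that $|N(S)| \le 2|S|-1$, where $N(S)$ denotes the set consisting of all vertices of $S$ together with all neighbors of vertices of $S$. -}

module Defs where

open import Data.Nat using (ℕ; _≤_; _*_; _∸_)
open import Data.Bool using (Bool; true; false; _∨_; _∧_)
open import Data.Fin using (Fin)
open import Data.Fin.Subset using (Subset; _∈_; _⊆_; ∣_∣)
open import Data.Vec using (tabulate; lookup)
open import Data.List using (List)
open import Data.List.Relation.Unary.All using (All)
open import Data.List.Relation.Unary.Any using (Any)
open import Data.List.Relation.Unary.AllPairs using (AllPairs)
open import Data.Product using (_×_; _,_; proj₁; proj₂; Σ)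
open import Data.Sum using (_⊎_)
open import Relation.Binary.PropositionalEquality using (_≡_; _≢_)
open import Relation.Nullary using (¬_)

record Graph (n : ℕ) : Set where
  field
    adj     : Fin n → Fin n → Bool
    symm    : ∀ u v → adj u v ≡ adj v u
    irrefl  : ∀ v → adj v v ≡ false

open Graph public

Edge : ∀ {n} → Graph n → Set
Edge {n} G = Σ (Fin n × Fin n) λ e → adj G (proj₁ e) (proj₂ e) ≡ true

_∈ₑ_ : ∀ {n} {G : Graph n} → Fin n → Edge G → Set
v ∈ₑ ((a , b) , _) = (v ≡ a) ⊎ (v ≡ b)

Disjoint : ∀ {n} {G : Graph n} → Edge G → Edge G → Set
Disjoint {G = G} e f = ∀ v → _∈ₑ_ {G = G} v e → ¬ (_∈ₑ_ {G = G} v f)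

IsMatching : ∀ {n} {G : Graph n} → List (Edge G) → Set
IsMatching {G = G} M = AllPairs (Disjoint {G = G}) M

Covers : ∀ {n} {G : Graph n} → List (Edge G) → Subset n → Set
Covers {G = G} M A = ∀ v → v ∈ A → Any (λ e → _∈ₑ_ {G = G} v e) M

anyFin : ∀ {n} → (Fin n → Bool) → Bool
anyFin {ℕ.zero} p = false
anyFin {ℕ.suc n} p = p Fin.zero ∨ anyFin (λ i → p (Fin.suc i))

N : ∀ {n} → Graph n → Subset n → Subset n
N G S = tabulate λ v → lookup S v ∨ anyFin (λ u → lookup S u ∧ adj G u v)

module Submission where

-- Prove the contrapositive in a form that survives induction: for a set W of still available
-- vertices with A ⊆ W, if |N[S] ∩ W| ≥ 2|S| for every S ⊆ A, then a matching inside W covers A.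
-- Induct on |W| plus the number of edges. If some nonempty S ⊂ A is tight (equality), cover S
-- inside N[S] ∩ W and then the rest of A inside W minus the vertices used: the condition passes
-- to both parts, the second because S used up at most 2|S| vertices of N[S] ∩ W. Otherwise every
-- such S has slack one. Pick a ∈ A and a neighbour b ∈ W. If b stays in N[A] without the edge ab,
-- delete that edge: each proper S loses at most one vertex of N[S], paid for by the slack, and
-- N[A] is unchanged. If not, b ∉ A and a is its only neighbour in A, so after matching a with b
-- and removing both, every S ⊆ A − a loses at most the vertex a.

open import Defs
open import Data.Bool using (Bool; true; false; _∨_; _∧_; not)
open import Data.Bool.Properties using (∧-conicalˡ; ∧-conicalʳ; ∧-comm; ∧-zeroʳ; ∨-comm; ∨-zeroʳ)
open import Data.Fin using (Fin; zero; suc; _≟_)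
open import Data.Fin.Properties using (any?)
open import Data.Fin.Subset
  using (Subset; _∈_; _∉_; _⊆_; _⊂_; _⊄_; ∣_∣; _∩_; _∪_; _─_; ⁅_⁆; ⊥; ⊤; Nonempty; Empty)
open import Data.Fin.Subset.Properties
  using ( _∈?_; _⊆?_; _⊂?_; nonempty?; anySubset?; ∈⊤; ∉⊥; x∈⁅x⁆; x∈⁅y⁆⇒x≡y
        ; x∈p∩q⁺; x∈p∩q⁻; x∈p∪q⁺; x∈p∪q⁻; p∩q⊆q; p⊆p∪q; p─q⊆p; x∈p∧x∉q⇒x∈p─q; ∩-identityʳ
        ; p⊆q⇒∣p∣≤∣q∣; p⊂q⇒∣p∣<∣q∣; ∣p∩q∣≤∣q∣; ∣⁅x⁆∣≡1; ∣⊥∣≡0; p∩q≢∅⇒∣p─q∣<∣p∣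
        ; Empty-unique; drop-∷-Empty )
open import Data.List using (List; []; _∷_; _++_; map)
open import Data.List.Relation.Unary.All as All using (All; []; _∷_)
import Data.List.Relation.Unary.All.Properties as Allₚ
open import Data.List.Relation.Unary.Any as Any using (Any; here; there)
import Data.List.Relation.Unary.Any.Properties as Anyₚ
open import Data.List.Relation.Unary.AllPairs using ([]; _∷_)
import Data.List.Relation.Unary.AllPairs.Properties as AllPairsₚ
open import Data.Nat using (ℕ; zero; suc; _+_; _*_; _≤_; _<_; z≤n; s≤s; _≤?_; _<?_)
open import Data.Nat.Properties hiding (_≟_)
open import Data.Product using (Σ; ∃; _×_; _,_)
open import Data.Sum using (_⊎_; inj₁; inj₂)
open import Data.Vec using (tabulate; lookup; []; _∷_; here; there)
open import Data.Vec.Properties using ([]=⇒lookup; lookup⇒[]=; lookup∘tabulate)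
open import Relation.Binary.PropositionalEquality
open import Relation.Nullary using (¬_; yes; no; does; contradiction; ¬?)
open import Relation.Nullary.Decidable using (_×-dec_; dec-true)

open import Algebra.Properties.Monoid.Sum +-0-monoid using (sum)

private
  variable
    n : ℕ
    x y : Fin n
    p q r S V W A : Subset n
    G H : Graph n

∨-true⁻ : ∀ {b c} → b ∨ c ≡ true → b ≡ true ⊎ c ≡ true
∨-true⁻ {true}  _ = inj₁ refl
∨-true⁻ {false} e = inj₂ e

≟-true⇒≡ : does (x ≟ y) ≡ true → x ≡ y
≟-true⇒≡ {x = x} {y} e with x ≟ y
... | yes x≡y = x≡y
... | no  _   = contradiction e λ ()

∈tabulate⁺ : ∀ {f : Fin n → Bool} → f x ≡ true → x ∈ tabulate f
∈tabulate⁺ {x = x} {f} e = lookup⇒[]= x (tabulate f) (trans (lookup∘tabulate f x) e)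

∈tabulate⁻ : ∀ {f : Fin n → Bool} → x ∈ tabulate f → f x ≡ true
∈tabulate⁻ {x = x} {f} x∈ = trans (sym (lookup∘tabulate f x)) ([]=⇒lookup x∈)

anyFin⁺ : ∀ (f : Fin n → Bool) x → f x ≡ true → anyFin f ≡ true
anyFin⁺ f zero    e rewrite e = refl
anyFin⁺ f (suc x) e rewrite anyFin⁺ (λ i → f (suc i)) x e = ∨-zeroʳ (f zero)

anyFin⁻ : ∀ (f : Fin n → Bool) → anyFin f ≡ true → ∃ λ x → f x ≡ true
anyFin⁻ {suc n} f e with ∨-true⁻ {f zero} e
... | inj₁ f0 = zero , f0
... | inj₂ fs = let x , fx = anyFin⁻ (λ i → f (suc i)) fs in suc x , fx

module _ (G : Graph n) where

  ∈N⁻ : ∀ {S v} → v ∈ N G S → v ∈ S ⊎ ∃ λ u → u ∈ S × adj G u v ≡ true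
  ∈N⁻ {S} v∈ with ∨-true⁻ (∈tabulate⁻ v∈)
  ... | inj₁ v∈S = inj₁ (lookup⇒[]= _ S v∈S)
  ... | inj₂ e with anyFin⁻ _ e
  ...   | u , uv = inj₂ (u , lookup⇒[]= u S (∧-conicalˡ _ _ uv) , ∧-conicalʳ _ _ uv)

  ⊆N : ∀ {S} → S ⊆ N G S
  ⊆N {S} {v} v∈S = ∈tabulate⁺ (cong (_∨ anyFin (λ u → lookup S u ∧ adj G u v)) ([]=⇒lookup v∈S))

  adj⇒∈N : ∀ {S u v} → u ∈ S → adj G u v ≡ true → v ∈ N G S
  adj⇒∈N {S} {u} u∈S uv = ∈tabulate⁺
    (trans (cong (lookup S _ ∨_) (anyFin⁺ _ u (cong₂ _∧_ ([]=⇒lookup u∈S) uv))) (∨-zeroʳ _))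

  N-mono : ∀ {S T} → S ⊆ T → N G S ⊆ N G T
  N-mono S⊆T v∈ with ∈N⁻ v∈
  ... | inj₁ v∈S            = ⊆N (S⊆T v∈S)
  ... | inj₂ (u , u∈S , uv) = adj⇒∈N (S⊆T u∈S) uv

  N-∪ : ∀ {S T} → N G (S ∪ T) ⊆ N G S ∪ N G T
  N-∪ {S} {T} v∈ with ∈N⁻ v∈
  ... | inj₁ v∈S∪T = x∈p∪q⁺ (Data.Sum.map ⊆N ⊆N (x∈p∪q⁻ S T v∈S∪T))
  ... | inj₂ (u , u∈S∪T , uv) =
    x∈p∪q⁺ (Data.Sum.map (λ u∈S → adj⇒∈N u∈S uv) (λ u∈T → adj⇒∈N u∈T uv) (x∈p∪q⁻ S T u∈S∪T))

x∈p─q⇒x∉q : x ∈ p ─ q → x ∉ q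
x∈p─q⇒x∉q {p = _ ∷ p} {q = true ∷ q} () here
x∈p─q⇒x∉q {p = _ ∷ p} {q = _    ∷ q} (there x∈p─q) (there x∈q) = x∈p─q⇒x∉q x∈p─q x∈q

─-monoˡ : p ⊆ q → p ─ r ⊆ q ─ r
─-monoˡ p⊆q x∈p─r = x∈p∧x∉q⇒x∈p─q (p⊆q (p─q⊆p _ _ x∈p─r)) (x∈p─q⇒x∉q x∈p─r)

∩-monoˡ : p ⊆ q → p ∩ r ⊆ q ∩ r
∩-monoˡ p⊆q x∈ = let x∈p , x∈r = x∈p∩q⁻ _ _ x∈ in x∈p∩q⁺ (p⊆q x∈p , x∈r)

p⊆q∪s⇒p∩r⊆q∩r∪s : ∀ {s} → p ⊆ q ∪ s → p ∩ r ⊆ (q ∩ r) ∪ s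
p⊆q∪s⇒p∩r⊆q∩r∪s {q = q} {s = s} p⊆q∪s x∈ with x∈p∩q⁻ _ _ x∈
... | x∈p , x∈r with x∈p∪q⁻ q s (p⊆q∪s x∈p)
...   | inj₁ x∈q = x∈p∪q⁺ (inj₁ (x∈p∩q⁺ (x∈q , x∈r)))
...   | inj₂ x∈s = x∈p∪q⁺ (inj₂ x∈s)

p⊆q∧p⊄q⇒q⊆p : p ⊆ q → p ⊄ q → q ⊆ p
p⊆q∧p⊄q⇒q⊆p {p = p} p⊆q p⊄q {x} x∈q with x ∈? p
... | yes x∈p = x∈p
... | no  x∉p = contradiction ((λ {y} → p⊆q {y}) , x , x∈q , x∉p) p⊄q

∣p∪q∣≤∣p∣+∣q∣ : ∀ (p q : Subset n) → ∣ p ∪ q ∣ ≤ ∣ p ∣ + ∣ q ∣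
∣p∪q∣≤∣p∣+∣q∣ []          []          = z≤n
∣p∪q∣≤∣p∣+∣q∣ (true  ∷ p) (true  ∷ q) = s≤s (≤-trans (∣p∪q∣≤∣p∣+∣q∣ p q) (+-monoʳ-≤ ∣ p ∣ (n≤1+n _)))
∣p∪q∣≤∣p∣+∣q∣ (true  ∷ p) (false ∷ q) = s≤s (∣p∪q∣≤∣p∣+∣q∣ p q)
∣p∪q∣≤∣p∣+∣q∣ (false ∷ p) (true  ∷ q) = ≤-trans (s≤s (∣p∪q∣≤∣p∣+∣q∣ p q)) (≤-reflexive (sym (+-suc _ _)))
∣p∪q∣≤∣p∣+∣q∣ (false ∷ p) (false ∷ q) = ∣p∪q∣≤∣p∣+∣q∣ p q

∣p∣+∣q∣≤∣p∪q∣ : ∀ (p q : Subset n) → Empty (p ∩ q) → ∣ p ∣ + ∣ q ∣ ≤ ∣ p ∪ q ∣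
∣p∣+∣q∣≤∣p∪q∣ []          []          _     = z≤n
∣p∣+∣q∣≤∣p∪q∣ (true  ∷ p) (true  ∷ q) empty = contradiction (zero , here) empty
∣p∣+∣q∣≤∣p∪q∣ (true  ∷ p) (false ∷ q) empty = s≤s (∣p∣+∣q∣≤∣p∪q∣ p q (drop-∷-Empty empty))
∣p∣+∣q∣≤∣p∪q∣ (false ∷ p) (true  ∷ q) empty =
  ≤-trans (≤-reflexive (+-suc _ _)) (s≤s (∣p∣+∣q∣≤∣p∪q∣ p q (drop-∷-Empty empty)))
∣p∣+∣q∣≤∣p∪q∣ (false ∷ p) (false ∷ q) empty = ∣p∣+∣q∣≤∣p∪q∣ p q (drop-∷-Empty empty)

p⊆q∪⁅x⁆⇒∣p∣≤1+∣q∣ : p ⊆ q ∪ ⁅ x ⁆ → ∣ p ∣ ≤ suc ∣ q ∣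
p⊆q∪⁅x⁆⇒∣p∣≤1+∣q∣ {p = p} {q = q} {x = x} p⊆ = begin
  ∣ p ∣               ≤⟨ p⊆q⇒∣p∣≤∣q∣ p⊆ ⟩
  ∣ q ∪ ⁅ x ⁆ ∣       ≤⟨ ∣p∪q∣≤∣p∣+∣q∣ q ⁅ x ⁆ ⟩
  ∣ q ∣ + ∣ ⁅ x ⁆ ∣   ≡⟨ cong (∣ q ∣ +_) (∣⁅x⁆∣≡1 x) ⟩
  ∣ q ∣ + 1           ≡⟨ +-comm ∣ q ∣ 1 ⟩
  suc ∣ q ∣           ∎
  where open ≤-Reasoning

Empty⇒∣p∣≡0 : Empty p → ∣ p ∣ ≡ 0
Empty⇒∣p∣≡0 {n} empty rewrite Empty-unique empty = ∣⊥∣≡0 n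

1<∣p∣⇒∃≢ : 1 < ∣ p ∣ → ∀ x → ∃ λ y → y ∈ p × y ≢ x
1<∣p∣⇒∃≢ {p = p} 1<∣p∣ x with any? (λ y → y ∈? p ×-dec ¬? (y ≟ x))
... | yes found = found
... | no ¬found = contradiction (p⊆q⇒∣p∣≤∣q∣ p⊆⁅x⁆) (<⇒≱ (subst (_< ∣ p ∣) (sym (∣⁅x⁆∣≡1 x)) 1<∣p∣))
  where
  p⊆⁅x⁆ : p ⊆ ⁅ x ⁆
  p⊆⁅x⁆ {y} y∈p with y ≟ x
  ... | yes refl = x∈⁅x⁆ x
  ... | no  y≢x  = contradiction (y , y∈p , y≢x) ¬found

sum-mono-≤ : ∀ {f g : Fin n → ℕ} → (∀ i → f i ≤ g i) → sum f ≤ sum g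
sum-mono-≤ {zero}  f≤g = z≤n
sum-mono-≤ {suc n} f≤g = +-mono-≤ (f≤g zero) (sum-mono-≤ (λ i → f≤g (suc i)))

sum-mono-< : ∀ {f g : Fin n → ℕ} → (∀ i → f i ≤ g i) → ∀ j → f j < g j → sum f < sum g
sum-mono-< f≤g zero    fj<gj = +-mono-<-≤ fj<gj (sum-mono-≤ (λ i → f≤g (suc i)))
sum-mono-< f≤g (suc j) fj<gj = +-mono-≤-< (f≤g zero) (sum-mono-< (λ i → f≤g (suc i)) j fj<gj)

neighbours : Graph n → Fin n → Subset n
neighbours G u = tabulate (adj G u)

degreeSum : Graph n → ℕ
degreeSum G = sum λ u → ∣ neighbours G u ∣

Subgraph : Graph n → Graph n → Set
Subgraph H G = ∀ {u v} → adj H u v ≡ true → adj G u v ≡ true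

degreeSum-<-Subgraph : ∀ {a b} → Subgraph H G →
                       adj G a b ≡ true → adj H a b ≡ false → degreeSum H < degreeSum G
degreeSum-<-Subgraph {H = H} {G} {a} {b} H⊆G ab∈G ab∉H = sum-mono-< (λ u → p⊆q⇒∣p∣≤∣q∣ (row⊆ u)) a
  (p⊂q⇒∣p∣<∣q∣ (row⊆ a , b , ∈tabulate⁺ ab∈G , b∉row))
  where
  b∉row : b ∉ neighbours H a
  b∉row b∈ = contradiction (trans (sym ab∉H) (∈tabulate⁻ b∈)) λ ()
  row⊆ : ∀ u → neighbours H u ⊆ neighbours G u
  row⊆ u v∈ = ∈tabulate⁺ (H⊆G (∈tabulate⁻ v∈))

module _ (G : Graph n) where

  _⊆ₑ_ : Edge G → Subset n → Set
  e ⊆ₑ W = ∀ v → _∈ₑ_ {G = G} v e → v ∈ W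

  MatchingIn : Subset n → Subset n → Set
  MatchingIn W A = Σ (List (Edge G)) λ M →
    IsMatching {G = G} M × Covers {G = G} M A × All (_⊆ₑ W) M

  vertices : List (Edge G) → Subset n
  vertices []                  = ⊥
  vertices (((a , b) , _) ∷ M) = (⁅ a ⁆ ∪ ⁅ b ⁆) ∪ vertices M

  ∈vertices⁺ : ∀ {v} M → Any (_∈ₑ_ {G = G} v) M → v ∈ vertices M
  ∈vertices⁺ (((a , b) , _) ∷ M) (here (inj₁ refl)) = x∈p∪q⁺ (inj₁ (x∈p∪q⁺ (inj₁ (x∈⁅x⁆ a))))
  ∈vertices⁺ (((a , b) , _) ∷ M) (here (inj₂ refl)) = x∈p∪q⁺ (inj₁ (x∈p∪q⁺ (inj₂ (x∈⁅x⁆ b))))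
  ∈vertices⁺ (_ ∷ M)             (there v∈M)         = x∈p∪q⁺ (inj₂ (∈vertices⁺ M v∈M))

  ∈vertices⁻ : ∀ {v} M → v ∈ vertices M → Any (_∈ₑ_ {G = G} v) M
  ∈vertices⁻ [] v∈ = contradiction v∈ ∉⊥
  ∈vertices⁻ (((a , b) , _) ∷ M) v∈ with x∈p∪q⁻ _ _ v∈
  ... | inj₂ v∈M = there (∈vertices⁻ M v∈M)
  ... | inj₁ v∈ab with x∈p∪q⁻ _ _ v∈ab
  ...   | inj₁ v∈a = here (inj₁ (x∈⁅y⁆⇒x≡y a v∈a))
  ...   | inj₂ v∈b = here (inj₂ (x∈⁅y⁆⇒x≡y b v∈b))

  ⊆ₑ-vertices : ∀ M → All (_⊆ₑ vertices M) M
  ⊆ₑ-vertices M = All.tabulate λ e∈M v v∈e → ∈vertices⁺ M (Any.map (λ { refl → v∈e }) e∈M)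

  vertices⊆ : ∀ {W} M → All (_⊆ₑ W) M → vertices M ⊆ W
  vertices⊆ M M⊆W {v} v∈V = let e⊆W , v∈e = All.lookupAny M⊆W (∈vertices⁻ M v∈V) in e⊆W v v∈e

  Covers⇒⊆vertices : ∀ {A} M → Covers {G = G} M A → A ⊆ vertices M
  Covers⇒⊆vertices M covers v∈A = ∈vertices⁺ M (covers _ v∈A)

  All-⊆ₑ-mono : ∀ {W W′ M} → W ⊆ W′ → All (_⊆ₑ W) M → All (_⊆ₑ W′) M
  All-⊆ₑ-mono W⊆W′ = All.map λ e⊆W v v∈e → W⊆W′ (e⊆W v v∈e)

  IsMatching-++ : ∀ {M₁ M₂ X Y} → IsMatching {G = G} M₁ → IsMatching {G = G} M₂ →
                  All (_⊆ₑ X) M₁ → All (_⊆ₑ Y) M₂ → Empty (X ∩ Y) →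
                  IsMatching {G = G} (M₁ ++ M₂)
  IsMatching-++ m₁ m₂ M₁⊆X M₂⊆Y X∩Y≡∅ = AllPairsₚ.++⁺ m₁ m₂
    (All.map (λ e⊆X → All.map (λ f⊆Y v v∈e v∈f → X∩Y≡∅ (v , x∈p∩q⁺ (e⊆X v v∈e , f⊆Y v v∈f))) M₂⊆Y) M₁⊆X)

  MatchingIn-extend : ∀ {W A} M → IsMatching {G = G} M → All (_⊆ₑ W) M →
                      MatchingIn (W ─ vertices M) (A ─ vertices M) → MatchingIn W A
  MatchingIn-extend {W} {A} M m M⊆W (M′ , m′ , covers′ , M′⊆W─V) =
    M ++ M′ , matching , covers , Allₚ.++⁺ M⊆W (All-⊆ₑ-mono (p─q⊆p W (vertices M)) M′⊆W─V)
    where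
    matching : IsMatching {G = G} (M ++ M′)
    matching = IsMatching-++ m m′ (⊆ₑ-vertices M) M′⊆W─V
      λ (v , v∈) → let v∈V , v∈W─V = x∈p∩q⁻ _ _ v∈ in x∈p─q⇒x∉q v∈W─V v∈V
    covers : Covers {G = G} (M ++ M′) A
    covers v v∈A with v ∈? vertices M
    ... | yes v∈V = Anyₚ.++⁺ˡ (∈vertices⁻ M v∈V)
    ... | no  v∉V = Anyₚ.++⁺ʳ M (covers′ v (x∈p∧x∉q⇒x∈p─q v∈A v∉V))

MatchingIn-Subgraph : Subgraph H G → MatchingIn H W A → MatchingIn G W A
MatchingIn-Subgraph {H = H} {G} H⊆G (M , m , covers , M⊆W) =
  map liftEdge M , AllPairsₚ.map⁺ m , (λ v v∈A → Anyₚ.map⁺ (covers v v∈A)) , Allₚ.map⁺ M⊆W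
  where
  liftEdge : Edge H → Edge G
  liftEdge (uv , e) = uv , H⊆G e

module _ (G : Graph n) (a b : Fin n) where

  private
    joins : Fin n → Fin n → Bool
    joins u v = (does (u ≟ a) ∧ does (v ≟ b)) ∨ (does (u ≟ b) ∧ does (v ≟ a))

    joins-comm : ∀ u v → joins u v ≡ joins v u
    joins-comm u v = trans (∨-comm (does (u ≟ a) ∧ does (v ≟ b)) _)
      (cong₂ _∨_ (∧-comm (does (u ≟ b)) (does (v ≟ a))) (∧-comm (does (u ≟ a)) (does (v ≟ b))))

  removeEdge : Graph n
  removeEdge = record
    { adj    = λ u v → adj G u v ∧ not (joins u v)
    ; symm   = λ u v → cong₂ (λ e j → e ∧ not j) (symm G u v) (joins-comm u v)
    ; irrefl = λ v → cong (_∧ not (joins v v)) (irrefl G v)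
    }

  removeEdge-Subgraph : Subgraph removeEdge G
  removeEdge-Subgraph uv = ∧-conicalˡ _ _ uv

  removeEdge-keeps : ∀ {u v} → adj G u v ≡ true →
                     adj removeEdge u v ≡ true ⊎ ((u ≡ a × v ≡ b) ⊎ (u ≡ b × v ≡ a))
  removeEdge-keeps {u} {v} uv with joins u v in j
  ... | false = inj₁ (cong (_∧ true) uv)
  ... | true with ∨-true⁻ j
  ...   | inj₁ e = inj₂ (inj₁ (≟-true⇒≡ (∧-conicalˡ _ _ e) , ≟-true⇒≡ (∧-conicalʳ _ _ e)))
  ...   | inj₂ e = inj₂ (inj₂ (≟-true⇒≡ (∧-conicalˡ _ _ e) , ≟-true⇒≡ (∧-conicalʳ _ _ e)))

  degreeSum-removeEdge : adj G a b ≡ true → degreeSum removeEdge < degreeSum G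
  degreeSum-removeEdge ab = degreeSum-<-Subgraph {H = removeEdge} {G} removeEdge-Subgraph ab ab∉removeEdge
    where
    ab∉removeEdge : adj removeEdge a b ≡ false
    ab∉removeEdge rewrite dec-true (a ≟ a) refl | dec-true (b ≟ b) refl = ∧-zeroʳ (adj G a b)

  ∈N-removeEdge⁻ : ∀ {S v} → v ∈ N G S → v ∈ N removeEdge S ⊎ ((a ∈ S × v ≡ b) ⊎ (b ∈ S × v ≡ a))
  ∈N-removeEdge⁻ {S} v∈N with ∈N⁻ G {S} v∈N
  ... | inj₁ v∈S = inj₁ (⊆N removeEdge {S} v∈S)
  ... | inj₂ (u , u∈S , uv) with removeEdge-keeps uv
  ...   | inj₁ uv′                 = inj₁ (adj⇒∈N removeEdge {S} u∈S uv′)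
  ...   | inj₂ (inj₁ (refl , v≡b)) = inj₂ (inj₁ (u∈S , v≡b))
  ...   | inj₂ (inj₂ (refl , v≡a)) = inj₂ (inj₂ (u∈S , v≡a))

  N-removeEdge-∈ : ∀ {S} → a ∈ S → N G S ⊆ N removeEdge S ∪ ⁅ b ⁆
  N-removeEdge-∈ {S} a∈S v∈N with ∈N-removeEdge⁻ {S} v∈N
  ... | inj₁ v∈N′              = x∈p∪q⁺ (inj₁ v∈N′)
  ... | inj₂ (inj₁ (_ , refl)) = x∈p∪q⁺ (inj₂ (x∈⁅x⁆ b))
  ... | inj₂ (inj₂ (_ , refl)) = x∈p∪q⁺ (inj₁ (⊆N removeEdge {S} a∈S))

  N-removeEdge-∉ : ∀ {S} → a ∉ S → N G S ⊆ N removeEdge S ∪ ⁅ a ⁆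
  N-removeEdge-∉ {S} a∉S v∈N with ∈N-removeEdge⁻ {S} v∈N
  ... | inj₁ v∈N′              = x∈p∪q⁺ (inj₁ v∈N′)
  ... | inj₂ (inj₁ (a∈S , _))  = contradiction a∈S a∉S
  ... | inj₂ (inj₂ (_ , refl)) = x∈p∪q⁺ (inj₂ (x∈⁅x⁆ a))

  N-removeEdge-⊇ : ∀ {S} → a ∈ S → b ∈ N removeEdge S → N G S ⊆ N removeEdge S
  N-removeEdge-⊇ {S} a∈S b∈N′ v∈N with ∈N-removeEdge⁻ {S} v∈N
  ... | inj₁ v∈N′              = v∈N′
  ... | inj₂ (inj₁ (_ , refl)) = b∈N′
  ... | inj₂ (inj₂ (_ , refl)) = ⊆N removeEdge {S} a∈S

-- The expansion condition relative to the available vertices W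

record Expands (G : Graph n) (W A : Subset n) : Set where
  constructor expanding
  field expands : ∀ S → S ⊆ A → 2 * ∣ S ∣ ≤ ∣ N G S ∩ W ∣

open Expands

Tight : Graph n → Subset n → Subset n → Subset n → Set
Tight G W A S = Nonempty S × S ⊂ A × ∣ N G S ∩ W ∣ ≤ 2 * ∣ S ∣

record Slack (G : Graph n) (W A : Subset n) : Set where
  constructor withSlack
  field slack : ∀ S → Nonempty S → S ⊂ A → 2 * ∣ S ∣ < ∣ N G S ∩ W ∣

open Slack

¬Tight⇒Slack : ¬ (∃ λ S → Tight G W A S) → Slack G W A
¬Tight⇒Slack ¬tight = withSlack λ S S≠∅ S⊂A → ≰⇒> λ N∩W≤2S → ¬tight (S , S≠∅ , S⊂A , N∩W≤2S)

nonempty⇒Expands : (∀ S → Nonempty S → S ⊆ A → 2 * ∣ S ∣ ≤ ∣ N G S ∩ W ∣) → Expands G W A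
nonempty⇒Expands expandsⁿᵉ .expands S S⊆A with nonempty? S
... | yes S≠∅ = expandsⁿᵉ S S≠∅ S⊆A
... | no  S≡∅ rewrite Empty⇒∣p∣≡0 S≡∅ = z≤n

Expands⇒adj : Expands G W A → x ∈ A → ∃ λ y → y ∈ W × adj G x y ≡ true
Expands⇒adj {G = G} {W} {A} {x = a} hall a∈A with 1<∣p∣⇒∃≢ 1<∣N⁅a⁆∩W∣ a
  where
  ⁅a⁆⊆A : ⁅ a ⁆ ⊆ A
  ⁅a⁆⊆A x∈ = subst (_∈ A) (sym (x∈⁅y⁆⇒x≡y a x∈)) a∈A
  1<∣N⁅a⁆∩W∣ : 1 < ∣ N G ⁅ a ⁆ ∩ W ∣
  1<∣N⁅a⁆∩W∣ = subst (λ k → 2 * k ≤ ∣ N G ⁅ a ⁆ ∩ W ∣) (∣⁅x⁆∣≡1 a) (expands hall ⁅ a ⁆ ⁅a⁆⊆A)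
... | y , y∈N∩W , y≢a with x∈p∩q⁻ _ _ y∈N∩W
...   | y∈N , y∈W with ∈N⁻ G y∈N
...     | inj₁ y∈⁅a⁆            = contradiction (x∈⁅y⁆⇒x≡y a y∈⁅a⁆) y≢a
...     | inj₂ (u , u∈⁅a⁆ , uy) = y , y∈W , subst (λ u → adj G u y ≡ true) (x∈⁅y⁆⇒x≡y a u∈⁅a⁆) uy

Tight⇒∣N∩W∣<∣W∣ : Expands G W A → Tight G W A S → ∣ N G S ∩ W ∣ < ∣ W ∣
Tight⇒∣N∩W∣<∣W∣ {G = G} {W} {A} {S} hall (_ , (S⊆A , a , a∈A , a∉S) , N∩W≤2S) = begin-strict
  ∣ N G S ∩ W ∣    ≤⟨ N∩W≤2S ⟩
  2 * ∣ S ∣        <⟨ *-monoʳ-< 2 (p⊂q⇒∣p∣<∣q∣ S⊂S′) ⟩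
  2 * ∣ S′ ∣       ≤⟨ expands hall S′ S′⊆A ⟩
  ∣ N G S′ ∩ W ∣   ≤⟨ ∣p∩q∣≤∣q∣ (N G S′) W ⟩
  ∣ W ∣            ∎
  where
  open ≤-Reasoning
  S′ = S ∪ ⁅ a ⁆
  S⊂S′ : S ⊂ S′
  S⊂S′ = p⊆p∪q ⁅ a ⁆ , a , x∈p∪q⁺ (inj₂ (x∈⁅x⁆ a)) , a∉S
  S′⊆A : S′ ⊆ A
  S′⊆A x∈S′ with x∈p∪q⁻ S ⁅ a ⁆ x∈S′
  ... | inj₁ x∈S   = S⊆A x∈S
  ... | inj₂ x∈⁅a⁆ = subst (_∈ A) (sym (x∈⁅y⁆⇒x≡y a x∈⁅a⁆)) a∈A

Expands-restrict : Expands G W A → S ⊆ A → Expands G (N G S ∩ W) S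
Expands-restrict {G = G} {W} {S = S} hall S⊆A .expands T T⊆S =
  ≤-trans (expands hall T (λ x∈T → S⊆A (T⊆S x∈T))) (p⊆q⇒∣p∣≤∣q∣ restrict)
  where
  restrict : N G T ∩ W ⊆ N G T ∩ (N G S ∩ W)
  restrict v∈ = let v∈N , v∈W = x∈p∩q⁻ _ _ v∈ in x∈p∩q⁺ (v∈N , x∈p∩q⁺ (N-mono G T⊆S v∈N , v∈W))

Expands-─ : Expands G W A → S ⊆ A → ∣ N G S ∩ W ∣ ≤ 2 * ∣ S ∣ →
            S ⊆ V → V ⊆ N G S ∩ W → Expands G (W ─ V) (A ─ V)
Expands-─ {G = G} {W} {A} {S} {V} hall S⊆A N∩W≤2S S⊆V V⊆N∩W .expands T T⊆A─V =
  +-cancelʳ-≤ (2 * ∣ S ∣) _ _ (begin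
    2 * ∣ T ∣ + 2 * ∣ S ∣                  ≡⟨ sym (*-distribˡ-+ 2 ∣ T ∣ ∣ S ∣) ⟩
    2 * (∣ T ∣ + ∣ S ∣)                    ≤⟨ *-monoʳ-≤ 2 (∣p∣+∣q∣≤∣p∪q∣ T S T∩S≡∅) ⟩
    2 * ∣ T ∪ S ∣                          ≤⟨ expands hall (T ∪ S) T∪S⊆A ⟩
    ∣ N G (T ∪ S) ∩ W ∣                    ≤⟨ p⊆q⇒∣p∣≤∣q∣ N[T∪S]∩W⊆ ⟩
    ∣ (N G T ∩ (W ─ V)) ∪ (N G S ∩ W) ∣    ≤⟨ ∣p∪q∣≤∣p∣+∣q∣ (N G T ∩ (W ─ V)) (N G S ∩ W) ⟩
    ∣ N G T ∩ (W ─ V) ∣ + ∣ N G S ∩ W ∣    ≤⟨ +-monoʳ-≤ ∣ N G T ∩ (W ─ V) ∣ N∩W≤2S ⟩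
    ∣ N G T ∩ (W ─ V) ∣ + 2 * ∣ S ∣        ∎)
  where
  open ≤-Reasoning
  T∩S≡∅ : Empty (T ∩ S)
  T∩S≡∅ (v , v∈T∩S) = let v∈T , v∈S = x∈p∩q⁻ T S v∈T∩S in x∈p─q⇒x∉q (T⊆A─V v∈T) (S⊆V v∈S)
  T∪S⊆A : T ∪ S ⊆ A
  T∪S⊆A v∈ with x∈p∪q⁻ T S v∈
  ... | inj₁ v∈T = p─q⊆p A V (T⊆A─V v∈T)
  ... | inj₂ v∈S = S⊆A v∈S
  N[T∪S]∩W⊆ : N G (T ∪ S) ∩ W ⊆ (N G T ∩ (W ─ V)) ∪ (N G S ∩ W)
  N[T∪S]∩W⊆ {v} v∈ with x∈p∩q⁻ _ _ v∈
  ... | v∈N , v∈W with x∈p∪q⁻ (N G T) (N G S) (N-∪ G {T} {S} v∈N) | v ∈? V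
  ...   | inj₂ v∈NS | _       = x∈p∪q⁺ (inj₂ (x∈p∩q⁺ (v∈NS , v∈W)))
  ...   | inj₁ _    | yes v∈V = x∈p∪q⁺ (inj₂ (V⊆N∩W v∈V))
  ...   | inj₁ v∈NT | no  v∉V = x∈p∪q⁺ (inj₁ (x∈p∩q⁺ (v∈NT , x∈p∧x∉q⇒x∈p─q v∈W v∉V)))

Expands-removeEdge : ∀ {a b} → Expands G W A → Slack G W A → a ∈ A → b ∈ N (removeEdge G a b) A →
                     Expands (removeEdge G a b) W A
Expands-removeEdge {G = G} {W} {A} {a} {b} hall hasSlack a∈A b∈N′ =
  nonempty⇒Expands {G = removeEdge G a b} expands′
  where
  losesOne : ∀ S → ∃ λ c → N G S ⊆ N (removeEdge G a b) S ∪ ⁅ c ⁆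
  losesOne S with a ∈? S
  ... | yes a∈S = b , N-removeEdge-∈ G a b a∈S
  ... | no  a∉S = a , N-removeEdge-∉ G a b a∉S
  expands′ : ∀ S → Nonempty S → S ⊆ A → 2 * ∣ S ∣ ≤ ∣ N (removeEdge G a b) S ∩ W ∣
  expands′ S S≠∅ S⊆A with S ⊂? A
  ... | yes S⊂A = let _ , N⊆ = losesOne S in
    ≤-pred (≤-trans (slack hasSlack S S≠∅ S⊂A) (p⊆q∪⁅x⁆⇒∣p∣≤1+∣q∣ (p⊆q∪s⇒p∩r⊆q∩r∪s N⊆)))
  ... | no  S⊄A = ≤-trans (expands hall S S⊆A) (p⊆q⇒∣p∣≤∣q∣ (∩-monoˡ N⊆))
    where
    N⊆ : N G S ⊆ N (removeEdge G a b) S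
    N⊆ v∈ = N-mono (removeEdge G a b) (p⊆q∧p⊄q⇒q⊆p S⊆A S⊄A)
              (N-removeEdge-⊇ G a b a∈A b∈N′ (N-mono G S⊆A v∈))

-- In G minus ab, b ∉ N[A] says exactly that b ∉ A and that a is b's only neighbour in A.
Expands-─-privateNeighbour : ∀ {a b} → Slack G W A → a ∈ A → b ∉ N (removeEdge G a b) A →
                             a ∈ V → (∀ {v} → v ∈ V → v ≡ a ⊎ v ≡ b) → Expands G (W ─ V) (A ─ V)
Expands-─-privateNeighbour {G = G} {W} {A} {V} {a} {b} hasSlack a∈A b∉N′ a∈V V⊆ab =
  nonempty⇒Expands {G = G} expands′
  where
  expands′ : ∀ S → Nonempty S → S ⊆ A ─ V → 2 * ∣ S ∣ ≤ ∣ N G S ∩ (W ─ V) ∣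
  expands′ S S≠∅ S⊆A─V = ≤-pred (≤-trans (slack hasSlack S S≠∅ S⊂A) (p⊆q∪⁅x⁆⇒∣p∣≤1+∣q∣ N∩W⊆))
    where
    S⊆A : S ⊆ A
    S⊆A x∈S = p─q⊆p A V (S⊆A─V x∈S)
    a∉S : a ∉ S
    a∉S a∈S = x∈p─q⇒x∉q (S⊆A─V a∈S) a∈V
    S⊂A : S ⊂ A
    S⊂A = S⊆A , a , a∈A , a∉S
    N∩W⊆ : N G S ∩ W ⊆ (N G S ∩ (W ─ V)) ∪ ⁅ a ⁆
    N∩W⊆ {v} v∈ with x∈p∩q⁻ _ _ v∈ | v ∈? V
    ... | v∈N , v∈W | no  v∉V = x∈p∪q⁺ (inj₁ (x∈p∩q⁺ (v∈N , x∈p∧x∉q⇒x∈p─q v∈W v∉V)))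
    ... | v∈N , v∈W | yes v∈V with V⊆ab v∈V
    ...   | inj₁ refl = x∈p∪q⁺ (inj₂ (x∈⁅x⁆ a))
    ...   | inj₂ refl with x∈p∪q⁻ _ _ (N-removeEdge-∉ G a b {S} a∉S v∈N)
    ...     | inj₁ b∈N′  = contradiction (N-mono (removeEdge G a b) S⊆A b∈N′) b∉N′
    ...     | inj₂ b∈⁅a⁆ = x∈p∪q⁺ (inj₂ b∈⁅a⁆)

-- Induction on the number of available vertices plus the degree sum

size : Graph n → Subset n → ℕ
size G W = ∣ W ∣ + degreeSum G

size-─ : x ∈ W → x ∈ V → size G (W ─ V) < size G W
size-─ {x = x} {W} {V} {G} x∈W x∈V =
  +-monoˡ-< (degreeSum G) (p∩q≢∅⇒∣p─q∣<∣p∣ W V (x , x∈p∩q⁺ (x∈W , x∈V)))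

Solvable : Graph n → Subset n → Set
Solvable G W = ∀ {A} → A ⊆ W → Expands G W A → MatchingIn G W A

SolvableBelow : Graph n → Subset n → Set
SolvableBelow {n} G W = ∀ (G′ : Graph n) W′ → size G′ W′ < size G W → Solvable G′ W′

matchTight : SolvableBelow G W → A ⊆ W → Expands G W A → Tight G W A S → MatchingIn G W A
matchTight {G = G} {W} {A} {S} solve A⊆W hall tight@((_ , s∈S) , (S⊆A , _) , N∩W≤2S)
  with solve G (N G S ∩ W) (+-monoˡ-< (degreeSum G) (Tight⇒∣N∩W∣<∣W∣ hall tight))
         {S} (λ x∈S → x∈p∩q⁺ (⊆N G x∈S , A⊆W (S⊆A x∈S))) (Expands-restrict hall S⊆A)
... | M₁ , m₁ , covers₁ , M₁⊆N∩W =
  MatchingIn-extend G M₁ m₁ (All-⊆ₑ-mono G (p∩q⊆q _ _) M₁⊆N∩W)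
    (solve G (W ─ vertices G M₁) (size-─ {G = G} (A⊆W (S⊆A s∈S)) (S⊆V s∈S)) (─-monoˡ A⊆W)
      (Expands-─ hall S⊆A N∩W≤2S S⊆V (vertices⊆ G M₁ M₁⊆N∩W)))
  where
  S⊆V : S ⊆ vertices G M₁
  S⊆V = Covers⇒⊆vertices G M₁ covers₁

matchAfterRemovingEdge : ∀ {a b} → SolvableBelow G W → A ⊆ W → Expands G W A → Slack G W A →
                         a ∈ A → adj G a b ≡ true → b ∈ N (removeEdge G a b) A → MatchingIn G W A
matchAfterRemovingEdge {G = G} {W} {a = a} {b} solve A⊆W hall hasSlack a∈A ab b∈N′ =
  MatchingIn-Subgraph {H = removeEdge G a b} {G} (removeEdge-Subgraph G a b)
    (solve (removeEdge G a b) W (+-monoʳ-< ∣ W ∣ (degreeSum-removeEdge G a b ab))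
      A⊆W (Expands-removeEdge hall hasSlack a∈A b∈N′))

matchPrivateNeighbour : ∀ {a b} → SolvableBelow G W → A ⊆ W → Slack G W A →
                        a ∈ A → b ∈ W → adj G a b ≡ true → b ∉ N (removeEdge G a b) A →
                        MatchingIn G W A
matchPrivateNeighbour {G = G} {W} {A} {a} {b} solve A⊆W hasSlack a∈A b∈W ab b∉N′ =
  MatchingIn-extend G [ab] ([] ∷ []) (ab⊆W ∷ [])
    (solve G (W ─ vertices G [ab]) (size-─ {G = G} (A⊆W a∈A) a∈V) (─-monoˡ A⊆W)
      (Expands-─-privateNeighbour hasSlack a∈A b∉N′ a∈V V⊆ab))
  where
  [ab] : List (Edge G)
  [ab] = ((a , b) , ab) ∷ []
  ab⊆W : _⊆ₑ_ G ((a , b) , ab) W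
  ab⊆W v (inj₁ refl) = A⊆W a∈A
  ab⊆W v (inj₂ refl) = b∈W
  a∈V : a ∈ vertices G [ab]
  a∈V = ∈vertices⁺ G [ab] (here (inj₁ refl))
  V⊆ab : ∀ {v} → v ∈ vertices G [ab] → v ≡ a ⊎ v ≡ b
  V⊆ab v∈V with ∈vertices⁻ G [ab] v∈V
  ... | here v∈ab = v∈ab

solvable-step : SolvableBelow G W → Solvable G W
solvable-step {G = G} {W} solve {A} A⊆W hall with nonempty? A
... | no  A≡∅ = [] , [] , (λ v v∈A → contradiction (v , v∈A) A≡∅) , []
... | yes (a , a∈A) with anySubset? (λ S → nonempty? S ×-dec (S ⊂? A ×-dec ∣ N G S ∩ W ∣ ≤? 2 * ∣ S ∣))
...   | yes (_ , tight) = matchTight solve A⊆W hall tight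
...   | no  ¬tight with Expands⇒adj hall a∈A
...     | b , b∈W , ab with b ∈? N (removeEdge G a b) A
...       | yes b∈N′ = matchAfterRemovingEdge solve A⊆W hall (¬Tight⇒Slack ¬tight) a∈A ab b∈N′
...       | no  b∉N′ = matchPrivateNeighbour solve A⊆W (¬Tight⇒Slack {G = G} {W} ¬tight) a∈A b∈W ab b∉N′

solvable : ∀ k → size G W < k → Solvable G W
solvable {G = G} {W} (suc k) size<1+k =
  solvable-step {G = G} {W} λ G′ W′ size′< →
    solvable {G = G′} {W′} k (<-≤-trans size′< (≤-pred size<1+k))

lemma6p1 : ∀ {n} (G : Graph n) (A : Subset n)
    → ¬ (Σ (List (Edge G)) λ M → IsMatching {G = G} M × Covers {G = G} M A)
    → Σ (Subset n) λ S → S ⊆ A × ∣ N G S ∣ < 2 * ∣ S ∣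
lemma6p1 G A no-matching with anySubset? (λ S → S ⊆? A ×-dec ∣ N G S ∣ <? 2 * ∣ S ∣)
... | yes deficient  = deficient
... | no  ¬deficient =
  let M , m , covers , _ = solvable {G = G} {⊤} (suc (size G ⊤)) ≤-refl (λ _ → ∈⊤) (expanding hall)
  in  contradiction (M , m , covers) no-matching
  where
  hall : ∀ S → S ⊆ A → 2 * ∣ S ∣ ≤ ∣ N G S ∩ ⊤ ∣
  hall S S⊆A = subst (λ X → 2 * ∣ S ∣ ≤ ∣ X ∣) (sym (∩-identityʳ (N G S)))
                     (≮⇒≥ λ N<2S → ¬deficient (S , S⊆A , N<2S))
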